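{- Let $G=(V,E)$ be an undirected graph with $|V|=n$, fix $\alpha\ge 1$, $\epsilon\in(0,1)$, $L = 2 + \lceil \log_{(1+\epsilon)} n \rceil$, and let $d^*= \max_{S \subseteq V} \rho(S)$. Let $\pi, \sigma > 0$ satisfy $\alpha \cdot \pi < d^* < \sigma/(2(1+\epsilon))$, and fix any integer $K \geq 2 + \lceil \log_{(1+\epsilon)} (\sigma / \pi) \rceil$. Define $d_{k} = (1+\epsilon)^{k-1} \cdot \pi$ for every $k \in [K]$, and for every $k \in [K]$ let $(Z_1(k), \ldots, Z_L(k))$ be an $(\alpha, d_k, L)$-decomposition of $G$. Let $k' = \max\{k \in [K] : Z_L(k) \neq \emptyset\}$. Then: 1. $d^*/(\alpha (1+\epsilon)) \leq d_{k'} \leq 2(1+\epsilon)^2 \cdot d^*$. 2. There exists an index $j' \in \{1, \ldots, L-1\}$ such that $\rho(Z_{j'}(k')) \geq d_{k'}/(2(1+\epsilon))$.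
   Context: For nonempty $S\subseteq V$, $\rho(S)=|E(S)|/|S|$, where $E(S)$ is the set of edges with both endpoints in $S$. $[K]=\{1,\dots,K\}$. For $v\in V$ and $S\subseteq V$, $D_v(S)$ is the number of neighbors of $v$ in $S$. Given $\alpha\ge1$, $d\ge0$, positive integer $L$, a tuple $(Z_1,\dots,Z_L)$ with $Z_1\supseteq\cdots\supseteq Z_L$ is an $(\alpha,d,L)$-decomposition of $G$ iff $Z_1=V$ and for every $i\in\{1,\dots,L-1\}$: $Z_{i+1}\supseteq\{v\in Z_i: D_v(Z_i)>\alpha d\}$ and $Z_{i+1}\cap\{v\in Z_i: D_v(Z_i)<d\}=\emptyset$.
   Formalization: The parameters α, ε, π and σ are taken to be rational numbers. -}

module Defs where

open import Data.Nat as ℕ using (ℕ; zero; suc)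
open import Data.Integer using (+_)
open import Data.Rational using (ℚ; _/_; 0ℚ; 1ℚ; _*_; _+_; _≤_; _<_)
open import Data.Bool using (Bool; true; false; if_then_else_)
open import Data.Fin using (Fin; toℕ)
open import Data.Fin.Subset using (Subset; ⊤; _∈_; _∉_; Nonempty; Empty)
open import Data.Product using (_×_; Σ; ∃)
open import Relation.Binary.PropositionalEquality using (_≡_)
open import Relation.Nullary using (¬_; does)
open import Data.Fin.Subset.Properties using (_∈?_)

record Graph (n : ℕ) : Set where
  field
    adj     : Fin n → Fin n → Bool
    adj-sym : ∀ u v → adj u v ≡ adj v u
    irrefl  : ∀ v → adj v v ≡ false
open Graph public

count : ∀ {n} → (Fin n → Bool) → ℕ
count {zero}  f = 0
count {suc n} f = (if f Data.Fin.zero then 1 else 0) ℕ.+ count {n} (λ i → f (Data.Fin.suc i))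

sumF : ∀ {n} → (Fin n → ℕ) → ℕ
sumF {zero}  f = 0
sumF {suc n} f = f Data.Fin.zero ℕ.+ sumF {n} (λ i → f (Data.Fin.suc i))

inS : ∀ {n} → Fin n → Subset n → Bool
inS v S = does (v ∈? S)

_∧_ : Bool → Bool → Bool
true ∧ b = b
false ∧ b = false

D : ∀ {n} → Graph n → Fin n → Subset n → ℕ
D G v S = count (λ u → inS u S ∧ adj G v u)

lessB : ℕ → ℕ → Bool
lessB m k = does (m ℕ.<? k)

-- |E(S)|: number of edges {u,v} (counted once, via toℕ u < toℕ v) with both ends in S
E : ∀ {n} → Graph n → Subset n → ℕ
E G S = sumF (λ u → count (λ v → lessB (toℕ u) (toℕ v) ∧ (inS u S ∧ (inS v S ∧ adj G u v))))

toℚ : ℕ → ℚ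
toℚ m = + m / 1

-- m / k as a rational (only used with k ≥ 1; value 0 for k = 0)
frac : ℕ → ℕ → ℚ
frac m zero    = 0ℚ
frac m (suc k) = + m / suc k

-- density ρ(S) = |E(S)| / |S|  (meaningful for nonempty S)
ρ : ∀ {n} → Graph n → Subset n → ℚ
ρ G S = frac (E G S) (Data.Fin.Subset.∣ S ∣)

IsMaxDensity : ∀ {n} → Graph n → ℚ → Set
IsMaxDensity G d = (∃ λ S → Nonempty S × ρ G S ≡ d) × (∀ S → Nonempty S → ρ G S ≤ d)

_^_ : ℚ → ℕ → ℚ
b ^ zero  = 1ℚ
b ^ suc k = b * (b ^ k)

-- c = ⌈ log_b x ⌉ for x ≥ 1 : least natural c with x ≤ b^c
IsCeilLog : ℚ → ℚ → ℕ → Set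
IsCeilLog b x c = (x ≤ b ^ c) × (∀ m → m ℕ.< c → b ^ m < x)

-- c = ⌈ log_b (σ/π) ⌉ for π > 0, σ/π ≥ 1, written with σ/π ≤ b^c ⇔ σ ≤ b^c·π
IsCeilLogRatio : ℚ → ℚ → ℚ → ℕ → Set
IsCeilLogRatio b σ π c = (σ ≤ (b ^ c) * π) × (∀ m → m ℕ.< c → (b ^ m) * π < σ)

-- (α,d,L)-decomposition: Z i is Z_i for i ∈ {1..L} (values at other indices irrelevant)
IsDecomposition : ∀ {n} → Graph n → ℚ → ℚ → ℕ → (ℕ → Subset n) → Set
IsDecomposition G α d L Z =
  (Z 1 ≡ ⊤) ×
  (∀ i → 1 ℕ.≤ i → i ℕ.< L →
      (∀ v → v ∈ Z (suc i) → v ∈ Z i)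
    × (∀ v → v ∈ Z i → α * d < toℚ (D G v (Z i)) → v ∈ Z (suc i))
    × (∀ v → v ∈ Z i → toℚ (D G v (Z i)) < d → v ∉ Z (suc i)))

-- A densest set S* has minimum degree at least d* (removing a vertex of smaller degree
-- would raise the density), so whenever α·d_k < d* every peeling step keeps all of S*, and the last
-- set Z_L(k) is nonempty. This holds for k = 1, so a largest such k′ exists; either the next
-- threshold d_{k′+1} = (1+ε)·d_{k′} already has empty last set, whence d* ≤ α(1+ε)·d_{k′}, or k′ = K
-- and d_K exceeds d* by the choice of K. Conversely, the vertices kept from Z_j have degree at
-- least d in Z_j, so |Z_{j+1}|·d ≤ 2|E(Z_j)|; if every Z_j had density below d/(2(1+ε)), each
-- step would shrink |Z_j| by the factor 1+ε, and (1+ε)^(L-1) > n would empty Z_L. Hence some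
-- Z_{j′}(k′) has density at least d_{k′}/(2(1+ε)), which is also at most d*.
module Submission where

open import Defs
import Data.Nat.Properties as ℕₚ
open import Algebra.Properties.CommutativeMonoid.Sum ℕₚ.+-0-commutativeMonoid using (sum-syntax)
open import Data.Bool using (Bool; true; false)
open import Data.Fin using (Fin; zero; suc; toℕ; _≟_)
open import Data.Fin.Subset using (Subset; _∈_; _⊆_; _-_; ⊤; Nonempty; Empty; ∣_∣)
open import Data.Fin.Subset.Properties
  using (_∈?_; nonempty?; x∈p⇒∣p-x∣<∣p∣; Empty-unique; ∣⊥∣≡0; ∣⊤∣≡n; ∈⊤)
open import Data.Nat as ℕ using (ℕ; zero; suc; _∸_; z≤n; s≤s)
open import Data.Product using (Σ; ∃; _×_; _,_; proj₁; proj₂)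
open import Data.Sum using (inj₁; inj₂)
open import Function using (_∘_)
open import Relation.Binary.PropositionalEquality
  using (_≡_; _≢_; refl; sym; trans; cong; cong₂; subst; module ≡-Reasoning)
open import Relation.Nullary using (¬_; Dec; does; yes; no)
open import Relation.Nullary.Negation using (contradiction)
open import Relation.Unary using (Decidable)

module Counting where

  open import Algebra.Properties.CommutativeMonoid.Sum ℕₚ.+-0-commutativeMonoid
    using (sum-cong-≗; ∑-distrib-+; ∑-comm; sum-replicate-zero)
  open import Algebra.Properties.CommutativeSemigroup ℕₚ.+-commutativeSemigroup
    using () renaming (interchange to +-interchange)
  open import Data.Fin.Properties using (toℕ-injective)
  open import Data.Fin.Subset using (⁅_⁆)
  open import Data.Fin.Subset.Properties using (p─q⊆p; x∈p∧x≢y⇒x∈p-y)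
  open import Data.Nat using (_+_; _*_; _≤_; _<_)
  open import Data.Vec using ([]; _∷_)
  open import Function using (mk⇔)
  open import Relation.Binary.Definitions using (tri<; tri≈; tri>)
  open import Relation.Nullary.Decidable using (dec-true; dec-false; does-⇔)

  [_] : Bool → ℕ
  [ true  ] = 1
  [ false ] = 0

  [a∧b]≤[b] : ∀ a b → [ a ∧ b ] ≤ [ b ]
  [a∧b]≤[b] true  b = ℕₚ.≤-refl
  [a∧b]≤[b] false b = z≤n

  [a∧[b∧c]]≤[a∧c] : ∀ a b c → [ a ∧ (b ∧ c) ] ≤ [ a ∧ c ]
  [a∧[b∧c]]≤[a∧c] true  b c = [a∧b]≤[b] b c
  [a∧[b∧c]]≤[a∧c] false b c = z≤n

  [∧]-monoˡ-≤ : ∀ {a a′} b → [ a ] ≤ [ a′ ] → [ a ∧ b ] ≤ [ a′ ∧ b ]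
  [∧]-monoˡ-≤ {false}        b _ = z≤n
  [∧]-monoˡ-≤ {true} {true}  b _ = ℕₚ.≤-refl
  [∧]-monoˡ-≤ {true} {false} b ()

  sumF≡∑ : ∀ {n} (f : Fin n → ℕ) → sumF f ≡ ∑[ i < n ] f i
  sumF≡∑ {zero}  f = refl
  sumF≡∑ {suc n} f = cong (f zero +_) (sumF≡∑ (f ∘ suc))

  count≡∑ : ∀ {n} (p : Fin n → Bool) → count p ≡ ∑[ i < n ] [ p i ]
  count≡∑ {zero}  p = refl
  count≡∑ {suc n} p with p zero
  ... | true  = cong suc (count≡∑ (p ∘ suc))
  ... | false = count≡∑ (p ∘ suc)

  ∣S∣≡∑ : ∀ {n} (S : Subset n) → ∣ S ∣ ≡ ∑[ u < n ] [ inS u S ]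
  ∣S∣≡∑ []          = refl
  ∣S∣≡∑ (true ∷ S)  = cong suc (∣S∣≡∑ S)
  ∣S∣≡∑ (false ∷ S) = ∣S∣≡∑ S

  ∑-mono-≤ : ∀ {n} {f g : Fin n → ℕ} → (∀ i → f i ≤ g i) → ∑[ i < n ] f i ≤ ∑[ i < n ] g i
  ∑-mono-≤ {zero}  f≤g = z≤n
  ∑-mono-≤ {suc n} f≤g = ℕₚ.+-mono-≤ (f≤g zero) (∑-mono-≤ (f≤g ∘ suc))

  ∑-δ : ∀ {n} (v : Fin n) (p : Fin n → Bool) → ∑[ u < n ] [ does (u ≟ v) ∧ p u ] ≡ [ p v ]
  ∑-δ {suc n} zero    p = trans (cong ([ p zero ] +_) (sum-replicate-zero n)) (ℕₚ.+-identityʳ _)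
  ∑-δ {suc n} (suc v) p = ∑-δ v (p ∘ suc)

  ∑∑-distrib-+ : ∀ {m n} (f g : Fin m → Fin n → ℕ) →
    ∑[ i < m ] ∑[ j < n ] (f i j + g i j) ≡ ∑[ i < m ] ∑[ j < n ] f i j + ∑[ i < m ] ∑[ j < n ] g i j
  ∑∑-distrib-+ {n = n} f g = trans (sum-cong-≗ λ i → ∑-distrib-+ (f i) (g i))
                                   (∑-distrib-+ (λ i → ∑[ j < n ] f i j) (λ i → ∑[ j < n ] g i j))

  ∑∑-mono-≤ : ∀ {m n} {f g : Fin m → Fin n → ℕ} → (∀ i j → f i j ≤ g i j) →
    ∑[ i < m ] ∑[ j < n ] f i j ≤ ∑[ i < m ] ∑[ j < n ] g i j
  ∑∑-mono-≤ f≤g = ∑-mono-≤ λ i → ∑-mono-≤ (f≤g i)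

  m+m≤n+n⇒m≤n : ∀ {m n} → m + m ≤ n + n → m ≤ n
  m+m≤n+n⇒m≤n m+m≤n+n = ℕₚ.≮⇒≥ λ n<m → ℕₚ.<⇒≱ (ℕₚ.+-mono-< n<m n<m) m+m≤n+n

  inS-mono-⊆ : ∀ {n} {S T : Subset n} → S ⊆ T → ∀ u → [ inS u S ] ≤ [ inS u T ]
  inS-mono-⊆ {S = S} {T} S⊆T u with u ∈? S
  ... | yes u∈S rewrite dec-true (u ∈? T) (S⊆T u∈S) = ℕₚ.≤-refl
  ... | no  _   = z≤n

  inS-remove : ∀ {n} {u v : Fin n} (S : Subset n) → u ≢ v → inS u (S - v) ≡ inS u S
  inS-remove {u = u} {v} S u≢v =
    does-⇔ (mk⇔ (p─q⊆p S ⁅ v ⁆) (λ u∈S → x∈p∧x≢y⇒x∈p-y u∈S u≢v)) (u ∈? S - v) (u ∈? S)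

  module _ {n} (G : Graph n) where

    arc : Subset n → Fin n → Fin n → Bool
    arc S u w = inS u S ∧ (inS w S ∧ adj G u w)

    arcs : Subset n → ℕ
    arcs S = ∑[ u < n ] ∑[ w < n ] [ arc S u w ]

    before : Fin n → Fin n → Bool
    before u w = lessB (toℕ u) (toℕ w)

    E≡∑∑ : ∀ S → E G S ≡ ∑[ u < n ] ∑[ w < n ] [ before u w ∧ arc S u w ]
    E≡∑∑ S = trans (sumF≡∑ (λ u → count (λ w → before u w ∧ arc S u w)))
                   (sum-cong-≗ λ u → count≡∑ (λ w → before u w ∧ arc S u w))

    D≡∑ : ∀ v S → D G v S ≡ ∑[ w < n ] [ inS w S ∧ adj G v w ]
    D≡∑ v S = count≡∑ (λ w → inS w S ∧ adj G v w)

    arc-sym : ∀ S u w → arc S u w ≡ arc S w u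
    arc-sym S u w rewrite adj-sym G u w with inS u S | inS w S
    ... | true  | true  = refl
    ... | true  | false = refl
    ... | false | true  = refl
    ... | false | false = refl

    arc-irrefl : ∀ S u → arc S u u ≡ false
    arc-irrefl S u rewrite irrefl G u with inS u S
    ... | true  = refl
    ... | false = refl

    arc-split : ∀ S u w → [ arc S u w ] ≡ [ before u w ∧ arc S u w ] + [ before w u ∧ arc S u w ]
    arc-split S u w with ℕₚ.<-cmp (toℕ u) (toℕ w)
    ... | tri< u<w _ w≮u
      rewrite dec-true (toℕ u ℕ.<? toℕ w) u<w | dec-false (toℕ w ℕ.<? toℕ u) w≮u
      = sym (ℕₚ.+-identityʳ _)
    ... | tri> u≮w _ w<u
      rewrite dec-false (toℕ u ℕ.<? toℕ w) u≮w | dec-true (toℕ w ℕ.<? toℕ u) w<u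
      = refl
    ... | tri≈ _ u≡w _
      rewrite toℕ-injective u≡w | arc-irrefl S w | dec-false (toℕ w ℕ.<? toℕ w) (ℕₚ.<-irrefl refl)
      = refl

    arcs≡E+E : ∀ S → arcs S ≡ E G S + E G S
    arcs≡E+E S = begin
      arcs S
        ≡⟨ sum-cong-≗ (λ u → sum-cong-≗ (arc-split S u)) ⟩
      ∑[ u < n ] ∑[ w < n ] ([ before u w ∧ arc S u w ] + [ before w u ∧ arc S u w ])
        ≡⟨ ∑∑-distrib-+ (λ u w → [ before u w ∧ arc S u w ]) (λ u w → [ before w u ∧ arc S u w ]) ⟩
      E′ + ∑[ u < n ] ∑[ w < n ] [ before w u ∧ arc S u w ]
        ≡⟨ cong (E′ +_) (∑-comm (λ u w → [ before w u ∧ arc S u w ])) ⟩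
      E′ + ∑[ w < n ] ∑[ u < n ] [ before w u ∧ arc S u w ]
        ≡⟨ cong (E′ +_) (sum-cong-≗ λ w → sum-cong-≗ λ u → cong (λ b → [ before w u ∧ b ]) (arc-sym S u w)) ⟩
      E′ + E′
        ≡⟨ cong₂ _+_ (E≡∑∑ S) (E≡∑∑ S) ⟨
      E G S + E G S ∎
      where
      open ≡-Reasoning
      E′ : ℕ
      E′ = ∑[ u < n ] ∑[ w < n ] [ before u w ∧ arc S u w ]

    degreeSum≡arcs : ∀ S → ∑[ u < n ] ([ inS u S ] * D G u S) ≡ arcs S
    degreeSum≡arcs S = sum-cong-≗ row
      where
      row : ∀ u → [ inS u S ] * D G u S ≡ ∑[ w < n ] [ arc S u w ]
      row u with inS u S
      ... | true  = trans (ℕₚ.+-identityʳ _) (D≡∑ u S)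
      ... | false = sym (sum-replicate-zero n)

    degreeSum-⊆ : ∀ {T S} → T ⊆ S → ∑[ u < n ] ([ inS u T ] * D G u S) ≤ E G S + E G S
    degreeSum-⊆ {T} {S} T⊆S = begin
      ∑[ u < n ] ([ inS u T ] * D G u S)  ≤⟨ ∑-mono-≤ (λ u → ℕₚ.*-monoˡ-≤ (D G u S) (inS-mono-⊆ T⊆S u)) ⟩
      ∑[ u < n ] ([ inS u S ] * D G u S)  ≡⟨ degreeSum≡arcs S ⟩
      arcs S                              ≡⟨ arcs≡E+E S ⟩
      E G S + E G S                       ∎
      where open ℕₚ.≤-Reasoning

    E-empty : ∀ {S} → Empty S → E G S ≡ 0
    E-empty {S} S=∅ = ℕₚ.n≤0⇒n≡0 (begin
      E G S                               ≤⟨ ℕₚ.m≤m+n _ _ ⟩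
      E G S + E G S                       ≡⟨ arcs≡E+E S ⟨
      arcs S                              ≡⟨ degreeSum≡arcs S ⟨
      ∑[ u < n ] ([ inS u S ] * D G u S)  ≡⟨ sum-cong-≗ (λ u → cong (λ b → [ b ] * D G u S) (u∉S u)) ⟩
      ∑[ u < n ] 0                        ≡⟨ sum-replicate-zero n ⟩
      0                                   ∎)
      where
      open ℕₚ.≤-Reasoning
      u∉S : ∀ u → inS u S ≡ false
      u∉S u = dec-false (u ∈? S) λ u∈S → S=∅ (u , u∈S)

    D-mono-⊆ : ∀ v {S T} → S ⊆ T → D G v S ≤ D G v T
    D-mono-⊆ v {S} {T} S⊆T = begin
      D G v S                             ≡⟨ D≡∑ v S ⟩
      ∑[ w < n ] [ inS w S ∧ adj G v w ]  ≤⟨ ∑-mono-≤ (λ w → [∧]-monoˡ-≤ (adj G v w) (inS-mono-⊆ S⊆T w)) ⟩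
      ∑[ w < n ] [ inS w T ∧ adj G v w ]  ≡⟨ D≡∑ v T ⟨
      D G v T                             ∎
      where open ℕₚ.≤-Reasoning

    arc-remove : ∀ S v u w → [ arc S u w ] ≤
      ([ does (u ≟ v) ∧ (inS w S ∧ adj G u w) ] + [ does (w ≟ v) ∧ (inS u S ∧ adj G u w) ]) + [ arc (S - v) u w ]
    arc-remove S v u w with u ≟ v | w ≟ v
    ... | yes refl | _        =
      ℕₚ.≤-trans ([a∧b]≤[b] (inS v S) _) (ℕₚ.≤-trans (ℕₚ.m≤m+n _ _) (ℕₚ.m≤m+n _ _))
    ... | no u≢v   | yes refl = ℕₚ.≤-trans ([a∧[b∧c]]≤[a∧c] (inS u S) (inS v S) _) (ℕₚ.m≤m+n _ _)
    ... | no u≢v   | no w≢v   rewrite inS-remove S u≢v | inS-remove S w≢v = ℕₚ.≤-refl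

    arcs-remove : ∀ S v → arcs S ≤ (D G v S + D G v S) + arcs (S - v)
    arcs-remove S v = begin
      arcs S
        ≤⟨ ∑∑-mono-≤ (arc-remove S v) ⟩
      ∑[ u < n ] ∑[ w < n ] ((out u w + in′ u w) + [ arc (S - v) u w ])
        ≡⟨ ∑∑-distrib-+ (λ u w → out u w + in′ u w) (λ u w → [ arc (S - v) u w ]) ⟩
      ∑[ u < n ] ∑[ w < n ] (out u w + in′ u w) + arcs (S - v)
        ≡⟨ cong (_+ arcs (S - v)) (∑∑-distrib-+ out in′) ⟩
      (∑[ u < n ] ∑[ w < n ] out u w + ∑[ u < n ] ∑[ w < n ] in′ u w) + arcs (S - v)
        ≡⟨ cong (_+ arcs (S - v)) (cong₂ _+_ ∑∑out≡D ∑∑in≡D) ⟩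
      (D G v S + D G v S) + arcs (S - v) ∎
      where
      open ℕₚ.≤-Reasoning
      out in′ : Fin n → Fin n → ℕ
      out u w = [ does (u ≟ v) ∧ (inS w S ∧ adj G u w) ]
      in′ u w = [ does (w ≟ v) ∧ (inS u S ∧ adj G u w) ]
      ∑∑out≡D : ∑[ u < n ] ∑[ w < n ] out u w ≡ D G v S
      ∑∑out≡D = trans (∑-comm out) (trans (sum-cong-≗ λ w → ∑-δ v (λ u → inS w S ∧ adj G u w))
                                          (sym (D≡∑ v S)))
      ∑∑in≡D : ∑[ u < n ] ∑[ w < n ] in′ u w ≡ D G v S
      ∑∑in≡D = trans (sum-cong-≗ λ u → trans (∑-δ v (λ w → inS u S ∧ adj G u w))
                                            (cong (λ b → [ inS u S ∧ b ]) (adj-sym G u v)))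
                     (sym (D≡∑ v S))

    E-remove : ∀ S v → E G S ≤ D G v S + E G (S - v)
    E-remove S v = m+m≤n+n⇒m≤n (begin
      E G S + E G S                                      ≡⟨ arcs≡E+E S ⟨
      arcs S                                             ≤⟨ arcs-remove S v ⟩
      (D G v S + D G v S) + arcs (S - v)                 ≡⟨ cong ((D G v S + D G v S) +_) (arcs≡E+E (S - v)) ⟩
      (D G v S + D G v S) + (E G (S - v) + E G (S - v))  ≡⟨ +-interchange (D G v S) _ (E G (S - v)) _ ⟩
      (D G v S + E G (S - v)) + (D G v S + E G (S - v))  ∎)
      where open ℕₚ.≤-Reasoning

open Counting

import Data.Integer as ℤ
open ℤ using (+_)
import Data.Integer.Properties as ℤₚ
open import Data.Rational using (ℚ; 0ℚ; 1ℚ; _+_; _*_; _≤_; _<_; toℚᵘ; positive; nonNegative)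
open import Data.Rational.Properties
open import Data.Rational.Solver using (module +-*-Solver)
import Data.Rational.Unnormalised as ℚᵘ
import Data.Rational.Unnormalised.Properties as ℚᵘₚ

toℚᵘ-toℚ : ∀ m → toℚᵘ (toℚ m) ℚᵘ.≃ ℚᵘ.mkℚᵘ (+ m) 0
toℚᵘ-toℚ m = toℚᵘ-fromℚᵘ (ℚᵘ.mkℚᵘ (+ m) 0)

toℚ-+ : ∀ a b → toℚ (a ℕ.+ b) ≡ toℚ a + toℚ b
toℚ-+ a b = toℚᵘ-injective (begin
  toℚᵘ (toℚ (a ℕ.+ b))                    ≈⟨ toℚᵘ-toℚ (a ℕ.+ b) ⟩
  ℚᵘ.mkℚᵘ (+ (a ℕ.+ b)) 0
    ≈⟨ ℚᵘ.*≡* (cong (ℤ._* + 1) (trans (ℤₚ.pos-+ a b) a+b≡a*1+b*1)) ⟩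
  ℚᵘ.mkℚᵘ (+ a) 0 ℚᵘ.+ ℚᵘ.mkℚᵘ (+ b) 0    ≈⟨ ℚᵘₚ.+-cong (toℚᵘ-toℚ a) (toℚᵘ-toℚ b) ⟨
  toℚᵘ (toℚ a) ℚᵘ.+ toℚᵘ (toℚ b)          ≈⟨ toℚᵘ-homo-+ (toℚ a) (toℚ b) ⟨
  toℚᵘ (toℚ a + toℚ b)                    ∎)
  where
  open ℚᵘₚ.≃-Reasoning
  a+b≡a*1+b*1 : + a ℤ.+ + b ≡ + a ℤ.* + 1 ℤ.+ + b ℤ.* + 1
  a+b≡a*1+b*1 = sym (cong₂ ℤ._+_ (ℤₚ.*-identityʳ (+ a)) (ℤₚ.*-identityʳ (+ b)))

toℚ-suc : ∀ m → toℚ (suc m) ≡ 1ℚ + toℚ m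
toℚ-suc = toℚ-+ 1

toℚ*frac≡toℚ : ∀ e k → toℚ (suc k) * frac e (suc k) ≡ toℚ e
toℚ*frac≡toℚ e k = toℚᵘ-injective (begin
  toℚᵘ (toℚ (suc k) * frac e (suc k))            ≈⟨ toℚᵘ-homo-* (toℚ (suc k)) (frac e (suc k)) ⟩
  toℚᵘ (toℚ (suc k)) ℚᵘ.* toℚᵘ (frac e (suc k))
    ≈⟨ ℚᵘₚ.*-cong (toℚᵘ-toℚ (suc k)) (toℚᵘ-fromℚᵘ (ℚᵘ.mkℚᵘ (+ e) k)) ⟩
  ℚᵘ.mkℚᵘ (+ suc k) 0 ℚᵘ.* ℚᵘ.mkℚᵘ (+ e) k       ≈⟨ ℚᵘ.*≡* cross ⟩
  ℚᵘ.mkℚᵘ (+ e) 0                                ≈⟨ toℚᵘ-toℚ e ⟨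
  toℚᵘ (toℚ e)                                   ∎)
  where
  open ℚᵘₚ.≃-Reasoning
  cross : (+ suc k ℤ.* + e) ℤ.* + 1 ≡ + e ℤ.* + (1 ℕ.* suc k)
  cross = trans (ℤₚ.*-identityʳ _)
            (trans (ℤₚ.*-comm (+ suc k) (+ e)) (cong (λ m → + e ℤ.* + m) (sym (ℕₚ.*-identityˡ (suc k)))))

toℚ-nonNeg : ∀ m → 0ℚ ≤ toℚ m
toℚ-nonNeg m = nonNegative⁻¹ (toℚ m) {{normalize-nonNeg m 1}}

toℚ-mono-≤ : ∀ {m n} → m ℕ.≤ n → toℚ m ≤ toℚ n
toℚ-mono-≤ {m} {n} m≤n = begin
  toℚ m                    ≡⟨ +-identityʳ (toℚ m) ⟨
  toℚ m + 0ℚ               ≤⟨ +-monoʳ-≤ (toℚ m) (toℚ-nonNeg (n ∸ m)) ⟩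
  toℚ m + toℚ (n ∸ m)      ≡⟨ toℚ-+ m (n ∸ m) ⟨
  toℚ (m ℕ.+ (n ∸ m))      ≡⟨ cong toℚ (ℕₚ.m+[n∸m]≡n m≤n) ⟩
  toℚ n                    ∎
  where open ≤-Reasoning

toℚ-∑-scaled-≤ : ∀ {m} {f g : Fin m → ℕ} {c} → (∀ i → toℚ (f i) * c ≤ toℚ (g i)) →
  toℚ (∑[ i < m ] f i) * c ≤ toℚ (∑[ i < m ] g i)
toℚ-∑-scaled-≤ {zero}          {c = c} fc≤g = ≤-reflexive (*-zeroˡ c)
toℚ-∑-scaled-≤ {suc m} {f} {g} {c}     fc≤g = begin
  toℚ (f zero ℕ.+ ∑f) * c        ≡⟨ cong (_* c) (toℚ-+ (f zero) ∑f) ⟩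
  (toℚ (f zero) + toℚ ∑f) * c    ≡⟨ *-distribʳ-+ c (toℚ (f zero)) (toℚ ∑f) ⟩
  toℚ (f zero) * c + toℚ ∑f * c  ≤⟨ +-mono-≤ (fc≤g zero) (toℚ-∑-scaled-≤ (fc≤g ∘ suc)) ⟩
  toℚ (g zero) + toℚ ∑g          ≡⟨ toℚ-+ (g zero) ∑g ⟨
  toℚ (g zero ℕ.+ ∑g)            ∎
  where
  open ≤-Reasoning
  ∑f ∑g : ℕ
  ∑f = ∑[ i < m ] f (suc i)
  ∑g = ∑[ i < m ] g (suc i)

*-monoˡ-≤ : ∀ {r p q} → 0ℚ ≤ r → p ≤ q → r * p ≤ r * q
*-monoˡ-≤ {r} 0≤r = *-monoˡ-≤-nonNeg r {{nonNegative 0≤r}}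

*-monoʳ-≤ : ∀ {r p q} → 0ℚ ≤ r → p ≤ q → p * r ≤ q * r
*-monoʳ-≤ {r} 0≤r = *-monoʳ-≤-nonNeg r {{nonNegative 0≤r}}

*-cancelʳ-≤ : ∀ {r p q} → 0ℚ < r → p * r ≤ q * r → p ≤ q
*-cancelʳ-≤ {r} 0<r = *-cancelʳ-≤-pos r {{positive 0<r}}

*-pos : ∀ {p q} → 0ℚ < p → 0ℚ < q → 0ℚ < p * q
*-pos {p} {q} 0<p 0<q = positive⁻¹ (p * q) {{pos*pos⇒pos p {{positive 0<p}} q {{positive 0<q}}}}

*-nonNeg : ∀ {p q} → 0ℚ ≤ p → 0ℚ ≤ q → 0ℚ ≤ p * q
*-nonNeg {p} {q} 0≤p 0≤q = nonNegative⁻¹ (p * q) {{nonNeg*nonNeg⇒nonNeg p {{nonNegative 0≤p}} q {{nonNegative 0≤q}}}}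

p≤c*p : ∀ {c p} → 1ℚ ≤ c → 0ℚ ≤ p → p ≤ c * p
p≤c*p {c} {p} 1≤c 0≤p = subst (_≤ c * p) (*-identityˡ p) (*-monoʳ-≤ 0≤p 1≤c)

^-pos : ∀ {b} → 0ℚ < b → ∀ m → 0ℚ < b ^ m
^-pos 0<b zero    = positive⁻¹ 1ℚ
^-pos 0<b (suc m) = *-pos 0<b (^-pos 0<b m)

^-mono-≤ : ∀ {b} → 1ℚ ≤ b → ∀ {m n} → m ℕ.≤ n → b ^ m ≤ b ^ n
^-mono-≤ 1≤b {zero}  {zero}  z≤n       = ≤-refl
^-mono-≤ 1≤b {zero}  {suc n} z≤n       =
  ≤-trans (^-mono-≤ 1≤b {zero} {n} z≤n) (p≤c*p 1≤b (<⇒≤ (^-pos (<-≤-trans (positive⁻¹ 1ℚ) 1≤b) n)))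
^-mono-≤ 1≤b {suc m} {suc n} (s≤s m≤n) =
  *-monoˡ-≤ (≤-trans (nonNegative⁻¹ 1ℚ) 1≤b) (^-mono-≤ 1≤b m≤n)

greatest-≤ : ∀ {p} {P : ℕ → Set p} → Decidable P → ∀ {m} K → P m → m ℕ.≤ K →
  ∃ λ k → m ℕ.≤ k × k ℕ.≤ K × P k × (∀ k′ → k ℕ.< k′ → k′ ℕ.≤ K → ¬ P k′)
greatest-≤ {P = P} P? zero Pm m≤0 =
  zero , m≤0 , z≤n , subst P (ℕₚ.n≤0⇒n≡0 m≤0) Pm , λ _ 0<k′ k′≤0 _ → ℕₚ.<⇒≱ 0<k′ k′≤0
greatest-≤ {P = P} P? (suc K) Pm m≤1+K with P? (suc K) | ℕₚ.m≤n⇒m<n∨m≡n m≤1+K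
... | yes P[1+K] | _         =
  suc K , m≤1+K , ℕₚ.≤-refl , P[1+K] , λ _ 1+K<k′ k′≤1+K _ → ℕₚ.<⇒≱ 1+K<k′ k′≤1+K
... | no ¬P[1+K] | inj₂ refl = contradiction Pm ¬P[1+K]
... | no ¬P[1+K] | inj₁ m<1+K with greatest-≤ P? K Pm (ℕₚ.≤-pred m<1+K)
...   | k , m≤k , k≤K , Pk , above = k , m≤k , ℕₚ.m≤n⇒m≤1+n k≤K , Pk , above′
  where
  above′ : ∀ k′ → k ℕ.< k′ → k′ ℕ.≤ suc K → ¬ P k′
  above′ k′ k<k′ k′≤1+K with ℕₚ.m≤n⇒m<n∨m≡n k′≤1+K
  ... | inj₁ k′<1+K = above k′ k<k′ (ℕₚ.≤-pred k′<1+K)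
  ... | inj₂ refl   = ¬P[1+K]

module _ {n} (G : Graph n) where

  ρ-nonNeg : ∀ S → 0ℚ ≤ ρ G S
  ρ-nonNeg S with ∣ S ∣
  ... | zero  = ≤-refl
  ... | suc k = nonNegative⁻¹ _ {{normalize-nonNeg (E G S) (suc k)}}

  ρ-empty : ∀ {S} → Empty S → ρ G S ≡ 0ℚ
  ρ-empty {S} S=∅ = cong (frac (E G S)) (trans (cong ∣_∣ (Empty-unique S=∅)) (∣⊥∣≡0 n))

  E≡∣S∣*ρ : ∀ S → toℚ (E G S) ≡ toℚ ∣ S ∣ * ρ G S
  E≡∣S∣*ρ S with ∣ S ∣ in ∣S∣≡
  ... | zero  = cong toℚ (E-empty G λ (u , u∈S) →
                   ℕₚ.n≮0 (subst (∣ S - u ∣ ℕ.<_) ∣S∣≡ (x∈p⇒∣p-x∣<∣p∣ u∈S)))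
  ... | suc k = sym (toℚ*frac≡toℚ (E G S) k)

  ∣T∣*d≤E+E : ∀ {T S d} → T ⊆ S → (∀ {u} → u ∈ T → d ≤ toℚ (D G u S)) →
    toℚ ∣ T ∣ * d ≤ toℚ (E G S ℕ.+ E G S)
  ∣T∣*d≤E+E {T} {S} {d} T⊆S minDegree = begin
    toℚ ∣ T ∣ * d                                ≡⟨ cong (λ m → toℚ m * d) (∣S∣≡∑ T) ⟩
    toℚ (∑[ u < n ] [ inS u T ]) * d             ≤⟨ toℚ-∑-scaled-≤ pointwise ⟩
    toℚ (∑[ u < n ] ([ inS u T ] ℕ.* D G u S))   ≤⟨ toℚ-mono-≤ (degreeSum-⊆ G T⊆S) ⟩
    toℚ (E G S ℕ.+ E G S)                        ∎
    where
    open ≤-Reasoning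
    pointwise : ∀ u → toℚ [ inS u T ] * d ≤ toℚ ([ inS u T ] ℕ.* D G u S)
    pointwise u with u ∈? T
    ... | yes u∈T = begin
      1ℚ * d               ≡⟨ *-identityˡ d ⟩
      d                    ≤⟨ minDegree u∈T ⟩
      toℚ (D G u S)        ≡⟨ cong toℚ (ℕₚ.+-identityʳ (D G u S)) ⟨
      toℚ (1 ℕ.* D G u S)  ∎
    ... | no  _   = ≤-reflexive (*-zeroˡ d)

module _ {n} (G : Graph n) {d* : ℚ} (d*-max : IsMaxDensity G d*) where

  maxDensity-nonNeg : 0ℚ ≤ d*
  maxDensity-nonNeg with proj₁ d*-max
  ... | S , _ , ρS≡d* = subst (0ℚ ≤_) ρS≡d* (ρ-nonNeg G S)

  ρ≤maxDensity : ∀ S → ρ G S ≤ d*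
  ρ≤maxDensity S with nonempty? S
  ... | yes S≠∅ = proj₂ d*-max S S≠∅
  ... | no  S=∅ = subst (_≤ d*) (sym (ρ-empty G S=∅)) maxDensity-nonNeg

  E≤∣S∣*maxDensity : ∀ S → toℚ (E G S) ≤ toℚ ∣ S ∣ * d*
  E≤∣S∣*maxDensity S = subst (_≤ toℚ ∣ S ∣ * d*) (sym (E≡∣S∣*ρ G S))
                         (*-monoˡ-≤ (toℚ-nonNeg ∣ S ∣) (ρ≤maxDensity S))

  densest-minDegree : ∀ {S v} → ρ G S ≡ d* → v ∈ S → d* ≤ toℚ (D G v S)
  densest-minDegree {S} {v} ρS≡d* v∈S = ≮⇒≥ λ D<d* → <-irrefl refl (begin-strict
    toℚ ∣ S ∣ * d*                     ≡⟨ trans (E≡∣S∣*ρ G S) (cong (toℚ ∣ S ∣ *_) ρS≡d*) ⟨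
    toℚ (E G S)                        ≤⟨ toℚ-mono-≤ (E-remove G S v) ⟩
    toℚ (D G v S ℕ.+ E G (S - v))      ≡⟨ toℚ-+ (D G v S) (E G (S - v)) ⟩
    toℚ (D G v S) + toℚ (E G (S - v))  <⟨ +-mono-<-≤ D<d* (E≤∣S∣*maxDensity (S - v)) ⟩
    d* + toℚ ∣ S - v ∣ * d*            ≡⟨ cong (_+ toℚ ∣ S - v ∣ * d*) (*-identityˡ d*) ⟨
    1ℚ * d* + toℚ ∣ S - v ∣ * d*       ≡⟨ *-distribʳ-+ d* 1ℚ (toℚ ∣ S - v ∣) ⟨
    (1ℚ + toℚ ∣ S - v ∣) * d*          ≡⟨ cong (_* d*) (toℚ-suc ∣ S - v ∣) ⟨
    toℚ (suc ∣ S - v ∣) * d*           ≤⟨ *-monoʳ-≤ maxDensity-nonNeg (toℚ-mono-≤ (x∈p⇒∣p-x∣<∣p∣ v∈S)) ⟩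
    toℚ ∣ S ∣ * d*                     ∎)
    where open ≤-Reasoning

  dense⇒threshold≤ : ∀ {b d S} → 1ℚ ≤ b → d ≤ (toℚ 2 * b) * ρ G S → d ≤ (toℚ 2 * b ^ 2) * d*
  dense⇒threshold≤ {b} {d} {S} 1≤b dense = begin
    d                      ≤⟨ dense ⟩
    (toℚ 2 * b) * ρ G S    ≤⟨ *-monoˡ-≤ (*-nonNeg (toℚ-nonNeg 2) 0≤b) (ρ≤maxDensity S) ⟩
    (toℚ 2 * b) * d*       ≤⟨ *-monoʳ-≤ maxDensity-nonNeg (*-monoˡ-≤ (toℚ-nonNeg 2) b≤b²) ⟩
    (toℚ 2 * b ^ 2) * d*   ∎
    where
    open ≤-Reasoning
    0≤b : 0ℚ ≤ b
    0≤b = ≤-trans (nonNegative⁻¹ 1ℚ) 1≤b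
    b≤b² : b ≤ b ^ 2
    b≤b² = subst (_≤ b ^ 2) (*-identityʳ b) (^-mono-≤ 1≤b {1} {2} (s≤s z≤n))

module Decomposition {n} (G : Graph n) (α d : ℚ) (L : ℕ) (Z : ℕ → Subset n)
                     (Z-dec : IsDecomposition G α d L Z) where

  Z₁≡V : Z 1 ≡ ⊤
  Z₁≡V = proj₁ Z-dec

  Z-shrinks : ∀ {i} → 1 ℕ.≤ i → i ℕ.< L → Z (suc i) ⊆ Z i
  Z-shrinks 1≤i i<L = proj₁ (proj₂ Z-dec _ 1≤i i<L) _

  high-degree-kept : ∀ {i v} → 1 ℕ.≤ i → i ℕ.< L → v ∈ Z i → α * d < toℚ (D G v (Z i)) → v ∈ Z (suc i)
  high-degree-kept 1≤i i<L = proj₁ (proj₂ (proj₂ Z-dec _ 1≤i i<L)) _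

  kept-degree : ∀ {i v} → 1 ℕ.≤ i → i ℕ.< L → v ∈ Z (suc i) → d ≤ toℚ (D G v (Z i))
  kept-degree 1≤i i<L v∈Z[1+i] =
    ≮⇒≥ λ D<d → proj₂ (proj₂ (proj₂ Z-dec _ 1≤i i<L)) _ (Z-shrinks 1≤i i<L v∈Z[1+i]) D<d v∈Z[1+i]

module _ {n} (G : Graph n) {d*} (d*-max : IsMaxDensity G d*)
         {α d L Z} (Z-dec : IsDecomposition G α d L Z) (αd<d* : α * d < d*) where

  open Decomposition G α d L Z Z-dec

  densest-kept : ∀ {S i} → ρ G S ≡ d* → 1 ℕ.≤ i → i ℕ.< L → S ⊆ Z i → S ⊆ Z (suc i)
  densest-kept {S} {i} ρS≡d* 1≤i i<L S⊆Zi {v} v∈S = high-degree-kept 1≤i i<L (S⊆Zi v∈S) (begin-strict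
    α * d              <⟨ αd<d* ⟩
    d*                 ≤⟨ densest-minDegree G d*-max ρS≡d* v∈S ⟩
    toℚ (D G v S)      ≤⟨ toℚ-mono-≤ (D-mono-⊆ G v S⊆Zi) ⟩
    toℚ (D G v (Z i))  ∎)
    where open ≤-Reasoning

  densest⊆Z : ∀ {S} → ρ G S ≡ d* → ∀ i → 1 ℕ.≤ i → i ℕ.≤ L → S ⊆ Z i
  densest⊆Z ρS≡d* (suc zero)    _ _   _ = subst (_ ∈_) (sym Z₁≡V) ∈⊤
  densest⊆Z ρS≡d* (suc (suc i)) _ i<L   =
    densest-kept ρS≡d* (s≤s z≤n) i<L (densest⊆Z ρS≡d* (suc i) (s≤s z≤n) (ℕₚ.<⇒≤ i<L))

  Z-last-nonempty : 1 ℕ.≤ L → Nonempty (Z L)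
  Z-last-nonempty 1≤L with proj₁ d*-max
  ... | S , (v , v∈S) , ρS≡d* = v , densest⊆Z ρS≡d* L 1≤L ℕₚ.≤-refl v∈S

Z-last-empty : ∀ {n} (G : Graph n) {d*} → IsMaxDensity G d* → ∀ {α d L Z} → IsDecomposition G α d L Z →
  1 ℕ.≤ L → Empty (Z L) → d* ≤ α * d
Z-last-empty G d*-max {α} Z-dec 1≤L ZL=∅ = ≮⇒≥ λ αd<d* → ZL=∅ (Z-last-nonempty G d*-max {α} Z-dec αd<d* 1≤L)

module _ {n} (G : Graph n) {α d L Z} (Z-dec : IsDecomposition G α d L Z) (0<d : 0ℚ < d)
         {b} (1<b : 1ℚ < b) where

  open Decomposition G α d L Z Z-dec

  0<b : 0ℚ < b
  0<b = <-trans (positive⁻¹ 1ℚ) 1<b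

  Dense : ℕ → Set
  Dense j = d ≤ (toℚ 2 * b) * ρ G (Z j)

  Dense? : ∀ j → Dec (Dense j)
  Dense? j = d ≤? (toℚ 2 * b) * ρ G (Z j)

  sparse-shrinks : ∀ {j} → 1 ℕ.≤ j → j ℕ.< L → ¬ Dense j → toℚ ∣ Z (suc j) ∣ * b ≤ toℚ ∣ Z j ∣
  sparse-shrinks {j} 1≤j j<L sparse = *-cancelʳ-≤ 0<d (begin
    (toℚ ∣ Z (suc j) ∣ * b) * d
      ≡⟨ solve 3 (λ x b d → (x :* b) :* d := b :* (x :* d)) refl (toℚ ∣ Z (suc j) ∣) b d ⟩
    b * (toℚ ∣ Z (suc j) ∣ * d)
      ≤⟨ *-monoˡ-≤ (<⇒≤ 0<b) (∣T∣*d≤E+E G (Z-shrinks 1≤j j<L) (kept-degree 1≤j j<L)) ⟩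
    b * toℚ (E G (Z j) ℕ.+ E G (Z j))
      ≡⟨ cong (b *_) (toℚ-+ (E G (Z j)) (E G (Z j))) ⟩
    b * (toℚ (E G (Z j)) + toℚ (E G (Z j)))
      ≡⟨ solve 2 (λ b e → b :* (e :+ e) := ((con 1ℚ :+ con 1ℚ) :* b) :* e) refl b (toℚ (E G (Z j))) ⟩
    (toℚ 2 * b) * toℚ (E G (Z j))
      ≡⟨ cong ((toℚ 2 * b) *_) (E≡∣S∣*ρ G (Z j)) ⟩
    (toℚ 2 * b) * (toℚ ∣ Z j ∣ * ρ G (Z j))
      ≡⟨ solve 3 (λ c x r → c :* (x :* r) := x :* (c :* r)) refl (toℚ 2 * b) (toℚ ∣ Z j ∣) (ρ G (Z j)) ⟩
    toℚ ∣ Z j ∣ * ((toℚ 2 * b) * ρ G (Z j))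
      ≤⟨ *-monoˡ-≤ (toℚ-nonNeg ∣ Z j ∣) (<⇒≤ (≰⇒> sparse)) ⟩
    toℚ ∣ Z j ∣ * d ∎)
    where
    open ≤-Reasoning
    open +-*-Solver

  sparse-prefix-bound : ∀ j → 1 ℕ.≤ j → j ℕ.≤ L → (∀ {i} → 1 ℕ.≤ i → i ℕ.< j → ¬ Dense i) →
    toℚ ∣ Z j ∣ * b ^ (j ∸ 1) ≤ toℚ n
  sparse-prefix-bound (suc zero) _ _ _ = ≤-reflexive (begin-equality
    toℚ ∣ Z 1 ∣ * 1ℚ  ≡⟨ *-identityʳ (toℚ ∣ Z 1 ∣) ⟩
    toℚ ∣ Z 1 ∣       ≡⟨ cong (toℚ ∘ ∣_∣) Z₁≡V ⟩
    toℚ ∣ ⊤ {n} ∣     ≡⟨ cong toℚ (∣⊤∣≡n n) ⟩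
    toℚ n             ∎)
    where open ≤-Reasoning
  sparse-prefix-bound (suc (suc i)) _ i<L sparse = begin
    toℚ ∣ Z (2 ℕ.+ i) ∣ * (b * b ^ i)
      ≡⟨ *-assoc (toℚ ∣ Z (2 ℕ.+ i) ∣) b (b ^ i) ⟨
    (toℚ ∣ Z (2 ℕ.+ i) ∣ * b) * b ^ i
      ≤⟨ *-monoʳ-≤ (<⇒≤ (^-pos 0<b i)) (sparse-shrinks (s≤s z≤n) i<L (sparse (s≤s z≤n) ℕₚ.≤-refl)) ⟩
    toℚ ∣ Z (suc i) ∣ * b ^ i
      ≤⟨ sparse-prefix-bound (suc i) (s≤s z≤n) (ℕₚ.<⇒≤ i<L) (λ 1≤k → sparse 1≤k ∘ ℕₚ.m≤n⇒m≤1+n) ⟩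
    toℚ n ∎
    where open ≤-Reasoning

  dense⇒nonempty : ∀ {j} → Dense j → Nonempty (Z j)
  dense⇒nonempty {j} dense with nonempty? (Z j)
  ... | yes Zj≠∅ = Zj≠∅
  ... | no  Zj=∅ = contradiction (begin-strict
    0ℚ                       <⟨ 0<d ⟩
    d                        ≤⟨ dense ⟩
    (toℚ 2 * b) * ρ G (Z j)  ≡⟨ cong ((toℚ 2 * b) *_) (ρ-empty G Zj=∅) ⟩
    (toℚ 2 * b) * 0ℚ         ≡⟨ *-zeroʳ (toℚ 2 * b) ⟩
    0ℚ                       ∎) (<-irrefl refl)
    where open ≤-Reasoning

  dense-level : ∀ {c} → L ≡ 2 ℕ.+ c → toℚ n ≤ b ^ c → Nonempty (Z L) →
    ∃ λ j → 1 ℕ.≤ j × j ℕ.< L × Nonempty (Z j) × Dense j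
  dense-level {c} refl n≤b^c (v , v∈ZL) with ℕₚ.anyUpTo? (Dense? ∘ suc) (suc c)
  ... | yes (i , i<1+c , dense) = suc i , s≤s z≤n , s≤s i<1+c , dense⇒nonempty dense , dense
  ... | no  none = contradiction (begin-strict
    b ^ c                    ≡⟨ *-identityˡ (b ^ c) ⟨
    1ℚ * b ^ c               <⟨ *-monoˡ-<-pos (b ^ c) {{positive (^-pos 0<b c)}} 1<b ⟩
    b ^ suc c                ≡⟨ *-identityˡ (b ^ suc c) ⟨
    1ℚ * b ^ suc c           ≤⟨ *-monoʳ-≤ (<⇒≤ (^-pos 0<b (suc c))) (toℚ-mono-≤ 1≤∣ZL∣) ⟩
    toℚ ∣ Z L ∣ * b ^ suc c  ≤⟨ sparse-prefix-bound L (s≤s z≤n) ℕₚ.≤-refl sparse ⟩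
    toℚ n                    ≤⟨ n≤b^c ⟩
    b ^ c                    ∎) (<-irrefl refl)
    where
    open ≤-Reasoning
    1≤∣ZL∣ : 1 ℕ.≤ ∣ Z L ∣
    1≤∣ZL∣ = ℕₚ.≤-trans (s≤s z≤n) (x∈p⇒∣p-x∣<∣p∣ v∈ZL)
    sparse : ∀ {i} → 1 ℕ.≤ i → i ℕ.< L → ¬ Dense i
    sparse {suc i} _ (s≤s i<1+c) dense = none (i , i<1+c , dense)

module Thresholds {n} (G : Graph n) {d*} (d*-max : IsMaxDensity G d*)
                  {α b π} (1≤α : 1ℚ ≤ α) (1≤b : 1ℚ ≤ b) (0<π : 0ℚ < π)
                  {L} (1≤L : 1 ℕ.≤ L) (K : ℕ) (Z : ℕ → ℕ → Subset n)
                  (Z-dec : ∀ k → 1 ℕ.≤ k → k ℕ.≤ K → IsDecomposition G α (b ^ (k ∸ 1) * π) L (Z k)) where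

  threshold : ℕ → ℚ
  threshold k = b ^ (k ∸ 1) * π

  0≤b : 0ℚ ≤ b
  0≤b = ≤-trans (nonNegative⁻¹ 1ℚ) 1≤b

  1≤2b : 1ℚ ≤ toℚ 2 * b
  1≤2b = ≤-trans 1≤b (p≤c*p (toℚ-mono-≤ {1} {2} (s≤s z≤n)) 0≤b)

  threshold-pos : ∀ k → 0ℚ < threshold k
  threshold-pos k = *-pos (^-pos (<-≤-trans (positive⁻¹ 1ℚ) 1≤b) (k ∸ 1)) 0<π

  first-level-nonempty : 1 ℕ.≤ K → α * π < d* → Nonempty (Z 1 L)
  first-level-nonempty 1≤K απ<d* =
    Z-last-nonempty G d*-max {α} (Z-dec 1 ℕₚ.≤-refl 1≤K) (subst (λ x → α * x < d*) (sym (*-identityˡ π)) απ<d*) 1≤L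

  below-top-threshold : ∀ {c σ m} → 1ℚ ≤ c → d* * c < σ → σ ≤ b ^ m * π → m ℕ.≤ K ∸ 1 → d* < threshold K
  below-top-threshold {c} {σ} {m} 1≤c d*c<σ σ≤b^mπ m≤K∸1 = begin-strict
    d*           ≤⟨ p≤c*p 1≤c (maxDensity-nonNeg G d*-max) ⟩
    c * d*       ≡⟨ *-comm c d* ⟩
    d* * c       <⟨ d*c<σ ⟩
    σ            ≤⟨ σ≤b^mπ ⟩
    b ^ m * π    ≤⟨ *-monoʳ-≤ (<⇒≤ 0<π) (^-mono-≤ 1≤b m≤K∸1) ⟩
    threshold K  ∎
    where open ≤-Reasoning

  maximal-level-bound : d* < threshold K → ∀ {k} → 1 ℕ.≤ k → k ℕ.≤ K →
    (∀ k′ → k ℕ.< k′ → k′ ℕ.≤ K → Empty (Z k′ L)) → d* ≤ (α * b) * threshold k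
  maximal-level-bound d*<top {suc k} _ 1+k≤K above with ℕₚ.m≤n⇒m<n∨m≡n 1+k≤K
  ... | inj₁ 1+k<K = begin
    d*
      ≤⟨ Z-last-empty G d*-max {α} (Z-dec (2 ℕ.+ k) (s≤s z≤n) 1+k<K) 1≤L (above (2 ℕ.+ k) ℕₚ.≤-refl 1+k<K) ⟩
    α * ((b * b ^ k) * π)
      ≡⟨ solve 4 (λ a b c p → a :* ((b :* c) :* p) := (a :* b) :* (c :* p)) refl α b (b ^ k) π ⟩
    (α * b) * (b ^ k * π) ∎
    where
    open ≤-Reasoning
    open +-*-Solver
  ... | inj₂ 1+k≡K = begin
    d*                     ≤⟨ <⇒≤ (subst (λ k → d* < threshold k) (sym 1+k≡K) d*<top) ⟩
    b ^ k * π              ≤⟨ p≤c*p (≤-trans 1≤b (p≤c*p 1≤α 0≤b)) (<⇒≤ (threshold-pos (suc k))) ⟩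
    (α * b) * (b ^ k * π)  ∎
    where open ≤-Reasoning

corollary2p7 :
    ∀ (n : ℕ) (G : Graph n) (α ε : ℚ) (L cL : ℕ) (dstar π σ : ℚ) (K cK : ℕ)
      (Z : ℕ → ℕ → Subset n) →
    1ℚ ≤ α → 0ℚ < ε → ε < 1ℚ →
    IsCeilLog (1ℚ + ε) (toℚ n) cL → L ≡ 2 ℕ.+ cL →
    IsMaxDensity G dstar →
    0ℚ < π → 0ℚ < σ →
    α * π < dstar → dstar * (toℚ 2 * (1ℚ + ε)) < σ →
    IsCeilLogRatio (1ℚ + ε) σ π cK → 2 ℕ.+ cK ℕ.≤ K →
    (∀ k → 1 ℕ.≤ k → k ℕ.≤ K →
      IsDecomposition G α (((1ℚ + ε) ^ (k ∸ 1)) * π) L (Z k)) →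
    Σ ℕ λ k′ →
      ((1 ℕ.≤ k′) × (k′ ℕ.≤ K) × Nonempty (Z k′ L)
        × (∀ k → k′ ℕ.< k → k ℕ.≤ K → Empty (Z k L)))
      × (dstar ≤ (α * (1ℚ + ε)) * (((1ℚ + ε) ^ (k′ ∸ 1)) * π))
      × ((((1ℚ + ε) ^ (k′ ∸ 1)) * π) ≤ (toℚ 2 * ((1ℚ + ε) ^ 2)) * dstar)
      × (∃ λ j′ → (1 ℕ.≤ j′) × (j′ ℕ.< L) × Nonempty (Z k′ j′)
          × (((1ℚ + ε) ^ (k′ ∸ 1)) * π ≤ (toℚ 2 * (1ℚ + ε)) * ρ G (Z k′ j′)))
corollary2p7 n G α ε L cL d* π σ K cK Z 1≤α 0<ε _ (n≤b^cL , _) L≡2+cL d*-max 0<π _ απ<d* d*2b<σ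
             (σ≤b^cK*π , _) 2+cK≤K Z-dec =
  let k′ , 1≤k′ , k′≤K , Zk′≠∅ , above =
        greatest-≤ (λ k → nonempty? (Z k L)) K (first-level-nonempty 1≤K απ<d*) 1≤K
      j′ , 1≤j′ , j′<L , Zj′≠∅ , dense =
        dense-level G {α} (Z-dec k′ 1≤k′ k′≤K) (threshold-pos k′) 1<b L≡2+cL n≤b^cL Zk′≠∅
  in  k′ , (1≤k′ , k′≤K , Zk′≠∅ , above) , maximal-level-bound d*<top 1≤k′ k′≤K above ,
      dense⇒threshold≤ G d*-max {S = Z k′ j′} (<⇒≤ 1<b) dense , j′ , 1≤j′ , j′<L , Zj′≠∅ , dense
  where
  b : ℚ
  b = 1ℚ + ε
  1<b : 1ℚ < b
  1<b = subst (_< b) (+-identityʳ 1ℚ) (+-monoʳ-< 1ℚ 0<ε)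
  1≤K : 1 ℕ.≤ K
  1≤K = ℕₚ.≤-trans (s≤s z≤n) 2+cK≤K
  open Thresholds G d*-max 1≤α (<⇒≤ 1<b) 0<π (subst (1 ℕ.≤_) (sym L≡2+cL) (s≤s z≤n)) K Z Z-dec
  d*<top : d* < threshold K
  d*<top = below-top-threshold 1≤2b d*2b<σ σ≤b^cK*π (ℕₚ.≤-trans (ℕₚ.n≤1+n cK) (ℕₚ.∸-monoˡ-≤ 1 2+cK≤K))
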